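{- Let $D\subsetneq\mathcal D$ be the set in assumption (A1), and let $S_1=\mathcal S(D)$. Assume (A1). Consider the two subgraphs of the matching graph obtained by deleting all edges between $S_1$ and $\mathcal D\setminus D$: \begin{itemize} \item $\mathcal G_1$, with vertex set $D\cup S_1$ and edges $\mathcal E\cap(D\times S_1)$; \item $\mathcal G_2$, with vertex set $(\mathcal D\setminus D)\cup(\mathcal S\setminus S_1)$ and edges $\mathcal E\cap\bigl((\mathcal D\setminus D)\times(\mathcal S\setminus S_1)\bigr)$. \end{itemize} Then both $\mathcal G_1$ and $\mathcal G_2$ are connected.
   Context: There are demand classes $\mathcal D=\{1,\dots,\ell_D\}$ and supply classes $\mathcal S=\{\ell_D+1,\dots,\ell\}$. The matching edge set $\mathcal E\subset\mathcal D\times\mathcal S$ does not depend on $\delta$, and the bipartite graph $(\mathcal D\cup\mathcal S,\mathcal E)$ is connected. \begin{itemize} \item $\mathcal S(D')=\{j:(i,j)\in\mathcal E\text{ for some }i\in D'\}$. \item $\xi^{D'}\in\mathbb{R}^\ell$ has entries $1$ on $D'$, $-1$ on $\mathcal S(D')$, and $0$ elsewhere. \end{itemize} There is a family of i.i.d. arrival processes $A^\delta$, $\delta\in[0,\bar\delta_\bullet]$ with $\bar\delta_\bullet\in(0,1)$. Each takes values in $\{\mathbf 1^i+\mathbf 1^j:(i,j)\in\mathcal A\}$ for a fixed $\mathcal A\subset\mathcal D\times\mathcal S$, and has mean $\alpha^\delta$. Assumption (A1): for one nonempty set $D\subsetneq\mathcal D$, $\xi^D\cdot\alpha^\delta=-\delta$.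 There is a fixed $\underline\delta>0$ such that $\xi^{D'}\cdot\alpha^\delta\le-\underline\delta$ for every nonempty $D'\subsetneq\mathcal D$ with $D'\ne D$ and every $\delta\in[0,\bar\delta_\bullet]$. -}

module Defs where

open import Level using (0ℓ)
open import Data.Nat using (ℕ; zero; suc)
open import Data.Fin using (Fin; zero; suc; splitAt; _↑ˡ_; _↑ʳ_; _≟_)
open import Data.Bool using (Bool; true; false; if_then_else_; _∧_; _∨_; not)
open import Data.Sum using (_⊎_; inj₁; inj₂; [_,_]′)
open import Data.Product using (_×_; ∃)
open import Data.Empty using (⊥)
open import Data.Unit using (⊤)
open import Relation.Nullary using (¬_)
open import Relation.Nullary.Decidable using (⌊_⌋)
open import Relation.Binary.PropositionalEquality using (_≡_; _≢_)
open import Relation.Binary.Structures using (IsTotalOrder)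
open import Relation.Binary.Construct.Closure.ReflexiveTransitive using (Star)
open import Algebra.Structures using (IsCommutativeRing)
open import Algebra.Core using (Op₁; Op₂)

-- Scalars: an arbitrary ordered field (ℝ is an instance).

record OrderedField : Set₁ where
  infixl 6 _+_
  infixl 7 _*_
  infix 8 -_
  infix 4 _≤_ _<_
  field
    Carrier : Set
    _+_ _*_ : Op₂ Carrier
    -_ : Op₁ Carrier
    0# 1# : Carrier
    _≤_ : Carrier → Carrier → Set
    isCommutativeRing : IsCommutativeRing _≡_ _+_ _*_ -_ 0# 1#
    0≢1 : 0# ≢ 1#
    inverse : ∀ x → x ≢ 0# → ∃ λ y → x * y ≡ 1#
    ≤-isTotalOrder : IsTotalOrder _≡_ _≤_
    +-monoˡ-≤ : ∀ {x y} z → x ≤ y → x + z ≤ y + z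
    *-nonneg : ∀ {x y} → 0# ≤ x → 0# ≤ y → 0# ≤ x * y

  _<_ : Carrier → Carrier → Set
  x < y = (x ≤ y) × (x ≢ y)

anyFin : ∀ {n} → (Fin n → Bool) → Bool
anyFin {zero} f = false
anyFin {suc n} f = f zero ∨ anyFin (λ i → f (suc i))

Nonempty : ∀ {n} → (Fin n → Bool) → Set
Nonempty P = ∃ λ i → P i ≡ true

Proper : ∀ {n} → (Fin n → Bool) → Set
Proper P = ∃ λ i → P i ≡ false

-- Demand classes: Fin ℓD; supply classes: Fin ℓS.
-- Matching edge set E ⊆ D × S as a characteristic function.
-- 𝒮(D') = { j : (i , j) ∈ E for some i ∈ D' }.
𝒮 : ∀ {ℓD ℓS} → (Fin ℓD → Fin ℓS → Bool) → (Fin ℓD → Bool) → Fin ℓS → Bool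
𝒮 E D' j = anyFin (λ i → D' i ∧ E i j)

-- Bipartite (sub)graphs and connectivity.
-- Vertices: Fin ℓD ⊎ Fin ℓS (demand classes, supply classes).

Adj : ∀ {ℓD ℓS} → (Fin ℓD → Fin ℓS → Bool) → Fin ℓD ⊎ Fin ℓS → Fin ℓD ⊎ Fin ℓS → Set
Adj e (inj₁ i) (inj₂ j) = e i j ≡ true
Adj e (inj₂ j) (inj₁ i) = e i j ≡ true
Adj e (inj₁ _) (inj₁ _) = ⊥
Adj e (inj₂ _) (inj₂ _) = ⊥

InV : ∀ {ℓD ℓS} → (Fin ℓD → Bool) → (Fin ℓS → Bool) → Fin ℓD ⊎ Fin ℓS → Set
InV Dv Sv (inj₁ i) = Dv i ≡ true
InV Dv Sv (inj₂ j) = Sv j ≡ true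

Connected : ∀ {ℓD ℓS} → (Fin ℓD → Bool) → (Fin ℓS → Bool) → (Fin ℓD → Fin ℓS → Bool) → Set
Connected Dv Sv e = ∀ u v → InV Dv Sv u → InV Dv Sv v → Star (Adj e) u v

allV : ∀ {n} → Fin n → Bool
allV _ = true

-- Vectors in F^ℓ, ℓ = ℓD + ℓS; classes 1..ℓD are demand (i ↑ˡ ℓS),
-- classes ℓD+1..ℓ are supply (ℓD ↑ʳ j).

module _ (F : OrderedField) where
  open OrderedField F

  Σ : ∀ {n} → (Fin n → Carrier) → Carrier
  Σ {zero} f = 0#
  Σ {suc n} f = f zero + Σ (λ i → f (suc i))

  _·_ : ∀ {n} → (Fin n → Carrier) → (Fin n → Carrier) → Carrier
  u · v = Σ (λ k → u k * v k)

  ξ : ∀ {ℓD ℓS} → (Fin ℓD → Fin ℓS → Bool) → (Fin ℓD → Bool) → Fin (ℓD Data.Nat.+ ℓS) → Carrier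
  ξ {ℓD} E D' k =
    [ (λ i → if D' i then 1# else 0#) , (λ j → if 𝒮 E D' j then - 1# else 0#) ]′ (splitAt ℓD k)

  𝟏 : ∀ {n} → Fin n → Fin n → Carrier
  𝟏 k k' = if ⌊ k ≟ k' ⌋ then 1# else 0#

  arrival : ∀ {ℓD ℓS} → Fin ℓD → Fin ℓS → Fin (ℓD Data.Nat.+ ℓS) → Carrier
  arrival {ℓD} {ℓS} i j k = 𝟏 (i ↑ˡ ℓS) k + 𝟏 (ℓD ↑ʳ j) k

  -- p is the law of a random vector with values in { 1^i + 1^j : (i,j) ∈ A }
  -- (p i j = probability of the arrival 1^i + 1^j).
  IsLawOn : ∀ {ℓD ℓS} → (Fin ℓD → Fin ℓS → Bool) → (Fin ℓD → Fin ℓS → Carrier) → Set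
  IsLawOn A p = (∀ i j → 0# ≤ p i j)
              × (∀ i j → A i j ≡ false → p i j ≡ 0#)
              × (Σ (λ i → Σ (λ j → p i j)) ≡ 1#)

  mean : ∀ {ℓD ℓS} → (Fin ℓD → Fin ℓS → Carrier) → Fin (ℓD Data.Nat.+ ℓS) → Carrier
  mean p k = Σ (λ i → Σ (λ j → p i j * arrival i j k))

module Submission where

-- Only the critical point δ = 0 of (A1) is used.  Let drift X = ξ^X · α:
-- drift D = 0, while drift X ≤ -δ̲ < 0 for every other nonempty proper X, so
-- two sets separating a pair of classes that D does not separate can never
-- have drifts summing to 0.  Drifts are modular,
--   drift X + drift Y = drift (X ∩ Y) + drift (X ∪ Y),
-- when every supply class adjacent to both X and Y is adjacent to X ∩ Y, and
-- drift ∅ = drift 𝒟 = 0 (ξ^𝒟 vanishes on every arrival 1^i + 1^j).  A cut C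
-- of 𝒢₁ splits D into X = D ∩ C, Y = D ∖ C (X ∩ Y = ∅, X ∪ Y = D); a cut C of
-- 𝒢₂ gives X = D ∪ C, Y = D ∪ (𝒟 ∖ C) (X ∩ Y = D, X ∪ Y = 𝒟).  Either way the
-- drifts cancel, a contradiction.  To turn "no cut" into an explicit walk we
-- compute components of finite graphs as the stationary stage of breadth-first
-- search.

open import Defs
open import Function using (_∘_)
open import Data.Nat using (ℕ; zero; suc; s≤s; z≤n) renaming (_≤_ to _≤ℕ_; _<_ to _<ℕ_)
open import Data.Nat.Properties using (≤-trans; m≤n⇒m≤1+n; +-mono-≤; +-mono-≤-<; <-irrefl)
open import Data.Fin using (Fin; zero; suc; splitAt; join; _↑ˡ_; _↑ʳ_; _≟_)
open import Data.Fin.Properties using (splitAt-join; splitAt-↑ˡ; splitAt-↑ʳ)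
open import Data.Bool using (Bool; true; false; _∧_; _∨_; not; if_then_else_)
open import Data.Bool.Properties using () renaming (_≟_ to _≟ᵇ_)
open import Data.Sum using (_⊎_; inj₁; inj₂)
open import Data.Product using (_×_; _,_; ∃; proj₁; proj₂)
open import Data.Empty using (⊥; ⊥-elim)
open import Relation.Nullary using (¬_; Dec; yes; no; does)
open import Relation.Nullary.Decidable using (dec-true)
open import Relation.Binary.PropositionalEquality
open import Relation.Binary.Construct.Closure.ReflexiveTransitive using (Star; ε; _◅_; _◅◅_)
open import Relation.Binary.Structures using (IsTotalOrder)
open import Algebra.Bundles using (CommutativeRing)
import Algebra.Properties.Semiring.Sum as SemiringSum

∧-elim : ∀ {a b} → a ∧ b ≡ true → a ≡ true × b ≡ true
∧-elim {true} {true} refl = refl , refl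

∧-intro : ∀ {a b} → a ≡ true → b ≡ true → a ∧ b ≡ true
∧-intro refl refl = refl

∨-elim : ∀ {a b} → a ∨ b ≡ true → a ≡ true ⊎ b ≡ true
∨-elim {true} _ = inj₁ refl
∨-elim {false} p = inj₂ p

∨-introˡ : ∀ {a} b → a ≡ true → a ∨ b ≡ true
∨-introˡ b refl = refl

∨-introʳ : ∀ a {b} → b ≡ true → a ∨ b ≡ true
∨-introʳ true _ = refl
∨-introʳ false p = p

true≢false : ∀ {a} → a ≡ true → a ≡ false → ⊥
true≢false refl ()

∨-resolve : ∀ {a b} → a ∨ b ≡ true → a ≡ false → b ≡ true
∨-resolve p refl = p

split-∩ : ∀ d c → (d ∧ c) ∧ (d ∧ not c) ≡ false
split-∩ true true = refl
split-∩ true false = refl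
split-∩ false c = refl

split-∪ : ∀ d c → (d ∧ c) ∨ (d ∧ not c) ≡ d
split-∪ true true = refl
split-∪ true false = refl
split-∪ false c = refl

extend-∩ : ∀ d c → (d ∨ c) ∧ (d ∨ not c) ≡ d
extend-∩ true c = refl
extend-∩ false true = refl
extend-∩ false false = refl

extend-∪ : ∀ d c → (d ∨ c) ∨ (d ∨ not c) ≡ true
extend-∪ true c = refl
extend-∪ false true = refl
extend-∪ false false = refl

false-if : ∀ {a b} → (a ≡ true → b ≡ true) → b ≡ false → a ≡ false
false-if {false} _ _ = refl
false-if {true} h b≡false = ⊥-elim (true≢false (h refl) b≡false)

not-true : ∀ {a} → not a ≡ true → a ≡ false
not-true {false} _ = refl

does-witness : ∀ {A : Set} (a? : Dec A) → does a? ≡ true → A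
does-witness (yes a) _ = a

anyFin-witness : ∀ {n} (f : Fin n → Bool) → anyFin f ≡ true → ∃ λ i → f i ≡ true
anyFin-witness {suc n} f p with ∨-elim {f zero} p
... | inj₁ q = zero , q
... | inj₂ q with anyFin-witness (f ∘ suc) q
...   | i , r = suc i , r

anyFin-intro : ∀ {n} (f : Fin n → Bool) i → f i ≡ true → anyFin f ≡ true
anyFin-intro f zero p = ∨-introˡ _ p
anyFin-intro f (suc i) p = ∨-introʳ (f zero) (anyFin-intro (f ∘ suc) i p)

anyFin-cong : ∀ {n} {f g : Fin n → Bool} → (∀ i → f i ≡ g i) → anyFin f ≡ anyFin g
anyFin-cong {zero} h = refl
anyFin-cong {suc n} h = cong₂ _∨_ (h zero) (anyFin-cong (h ∘ suc))

anyFin-false : ∀ n → anyFin {n} (λ _ → false) ≡ false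
anyFin-false zero = refl
anyFin-false (suc n) = anyFin-false n

_⊆_ : ∀ {A : Set} → (A → Bool) → (A → Bool) → Set
P ⊆ Q = ∀ x → P x ≡ true → Q x ≡ true

_∩_ _∪_ : ∀ {A : Set} → (A → Bool) → (A → Bool) → A → Bool
(X ∩ Y) a = X a ∧ Y a
(X ∪ Y) a = X a ∨ Y a

module Neighbours {ℓD ℓS : ℕ} (E : Fin ℓD → Fin ℓS → Bool) where

  𝒮-witness : ∀ X {j} → 𝒮 E X j ≡ true → ∃ λ i → X i ≡ true × E i j ≡ true
  𝒮-witness X {j} p with anyFin-witness (λ i → X i ∧ E i j) p
  ... | i , q = i , ∧-elim q

  𝒮-intro : ∀ X {i j} → X i ≡ true → E i j ≡ true → 𝒮 E X j ≡ true
  𝒮-intro X {i} {j} Xi Eij = anyFin-intro (λ i → X i ∧ E i j) i (∧-intro Xi Eij)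

  𝒮-mono : ∀ {X Y} → X ⊆ Y → 𝒮 E X ⊆ 𝒮 E Y
  𝒮-mono {X} {Y} X⊆Y j p with 𝒮-witness X p
  ... | i , Xi , Eij = 𝒮-intro Y (X⊆Y i Xi) Eij

  𝒮-cong : ∀ {X Y} → (∀ i → X i ≡ Y i) → ∀ j → 𝒮 E X j ≡ 𝒮 E Y j
  𝒮-cong X≗Y j = anyFin-cong (λ i → cong (_∧ E i j) (X≗Y i))

  𝒮-∅ : ∀ j → 𝒮 E (λ _ → false) j ≡ false
  𝒮-∅ j = anyFin-false ℓD

  𝒮-∪ : ∀ X Y j → 𝒮 E (X ∪ Y) j ≡ 𝒮 E X j ∨ 𝒮 E Y j
  𝒮-∪ X Y j with 𝒮 E X j in SX | 𝒮 E Y j in SY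
  ... | true  | _     = 𝒮-mono (λ i → ∨-introˡ (Y i)) j SX
  ... | false | true  = 𝒮-mono (λ i → ∨-introʳ (X i)) j SY
  ... | false | false = false-if inX∪Y SX
    where
    inX∪Y : 𝒮 E (X ∪ Y) j ≡ true → 𝒮 E X j ≡ true
    inX∪Y p with 𝒮-witness (X ∪ Y) p
    ... | i , XYi , Eij with ∨-elim {X i} XYi
    ...   | inj₁ Xi = 𝒮-intro X Xi Eij
    ...   | inj₂ Yi = ⊥-elim (true≢false (𝒮-intro Y Yi Eij) SY)

  𝒮-∩ : ∀ X Y →
    (∀ {a b j} → X a ≡ true → Y b ≡ true → E a j ≡ true → E b j ≡ true → 𝒮 E (X ∩ Y) j ≡ true) →
    ∀ j → 𝒮 E (X ∩ Y) j ≡ 𝒮 E X j ∧ 𝒮 E Y j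
  𝒮-∩ X Y shared j with 𝒮 E X j in SX | 𝒮 E Y j in SY
  ... | true  | true with 𝒮-witness X SX | 𝒮-witness Y SY
  ...   | a , Xa , Eaj | b , Yb , Ebj = shared Xa Yb Eaj Ebj
  𝒮-∩ X Y shared j | true  | false = false-if (𝒮-mono (λ i → proj₂ ∘ ∧-elim {X i}) j) SY
  𝒮-∩ X Y shared j | false | _     = false-if (𝒮-mono (λ i → proj₁ ∘ ∧-elim {X i}) j) SX

-- Every proper step of an increasing chain of subsets of Fin n increases the
-- size, which is bounded by n; hence the chain stabilises.

bit : Bool → ℕ
bit b = if b then 1 else 0

size : ∀ {n} → (Fin n → Bool) → ℕ
size {zero} P = 0
size {suc n} P = bit (P zero) Data.Nat.+ size (P ∘ suc)

size≤n : ∀ {n} (P : Fin n → Bool) → size P ≤ℕ n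
size≤n {zero} P = z≤n
size≤n {suc n} P with P zero
... | true = s≤s (size≤n (P ∘ suc))
... | false = m≤n⇒m≤1+n (size≤n (P ∘ suc))

bit-mono : ∀ {a b} → (a ≡ true → b ≡ true) → bit a ≤ℕ bit b
bit-mono {false} h = z≤n
bit-mono {true} h rewrite h refl = s≤s z≤n

size-mono : ∀ {n} {P Q : Fin n → Bool} → P ⊆ Q → size P ≤ℕ size Q
size-mono {zero} P⊆Q = z≤n
size-mono {suc n} P⊆Q = +-mono-≤ (bit-mono (P⊆Q zero)) (size-mono (P⊆Q ∘ suc))

size-strict : ∀ {n} {P Q : Fin n → Bool} → P ⊆ Q →
  ∀ x → P x ≡ false → Q x ≡ true → size P <ℕ size Q
size-strict P⊆Q zero Px Qx rewrite Px | Qx = s≤s (size-mono (P⊆Q ∘ suc))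
size-strict P⊆Q (suc x) Px Qx =
  +-mono-≤-< (bit-mono (P⊆Q zero)) (size-strict (P⊆Q ∘ suc) x Px Qx)

⊆-or-new : ∀ {n} (P Q : Fin n → Bool) → Q ⊆ P ⊎ ∃ λ x → P x ≡ false × Q x ≡ true
⊆-or-new P Q with anyFin (λ x → Q x ∧ not (P x)) in new
... | true with anyFin-witness _ new
...   | x , Qx∧¬Px with ∧-elim {Q x} Qx∧¬Px
...     | Qx , ¬Px = inj₂ (x , not-true ¬Px , Qx)
⊆-or-new P Q | false = inj₁ Q⊆P
  where
  Q⊆P : Q ⊆ P
  Q⊆P x Qx with P x in Px
  ... | true = refl
  ... | false = ⊥-elim (true≢false (anyFin-intro _ x (∧-intro Qx (cong not Px))) new)

module _ {n} (C : ℕ → Fin n → Bool) (increasing : ∀ k → C k ⊆ C (suc k)) where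

  grows : ∀ k → (∃ λ k → C (suc k) ⊆ C k) ⊎ k ≤ℕ size (C k)
  grows zero = inj₂ z≤n
  grows (suc k) with grows k
  ... | inj₁ stable = inj₁ stable
  ... | inj₂ k≤size with ⊆-or-new (C k) (C (suc k))
  ...   | inj₁ stable = inj₁ (k , stable)
  ...   | inj₂ (x , out , new) =
          inj₂ (≤-trans (s≤s k≤size) (size-strict (increasing k) x out new))

  stabilises : ∃ λ k → C (suc k) ⊆ C k
  stabilises with grows (suc n)
  ... | inj₁ stable = stable
  ... | inj₂ tooBig = ⊥-elim (<-irrefl refl (≤-trans tooBig (size≤n (C (suc n)))))

record Component {V : Set} (R : V → V → Set) (s : V) : Set where
  field
    member    : V → Bool
    source    : member s ≡ true
    reachable : ∀ {v} → member v ≡ true → Star R s v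
    closed    : ∀ {u v} → member u ≡ true → R u v → member v ≡ true

-- The component is the limit of the breadth-first
-- stages  C 0 = {s},  C (k+1) = C k ∪ neighbours of C k,  which stabilise.
module FiniteComponent {V : Set} {n : ℕ} (enum : Fin n → V) (index : V → Fin n)
    (enum-index : ∀ v → enum (index v) ≡ v)
    {R : V → V → Set} (R? : ∀ u v → Dec (R u v)) (s : V) where

  stage : ℕ → V → Bool
  stage zero v = does (index s ≟ index v)
  stage (suc k) v = stage k v ∨ anyFin (λ i → stage k (enum i) ∧ does (R? (enum i) v))

  stage-reachable : ∀ k {v} → stage k v ≡ true → Star R s v
  stage-reachable zero {v} p = subst (Star R s) s≡v ε
    where
    s≡v : s ≡ v
    s≡v = trans (sym (enum-index s))
            (trans (cong enum (does-witness (index s ≟ index v) p)) (enum-index v))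
  stage-reachable (suc k) {v} p with ∨-elim {stage k v} p
  ... | inj₁ q = stage-reachable k q
  ... | inj₂ q with anyFin-witness (λ i → stage k (enum i) ∧ does (R? (enum i) v)) q
  ...   | i , r with ∧-elim {stage k (enum i)} r
  ...     | Ci , Riv = stage-reachable k Ci ◅◅ (does-witness (R? (enum i) v) Riv ◅ ε)

  stage-source : ∀ k → stage k s ≡ true
  stage-source zero = dec-true (index s ≟ index s) refl
  stage-source (suc k) = ∨-introˡ _ (stage-source k)

  stage-increasing : ∀ k → stage k ⊆ stage (suc k)
  stage-increasing k v = ∨-introˡ _

  stage-closed : ∀ k → stage (suc k) ⊆ stage k →
    ∀ {u v} → stage k u ≡ true → R u v → stage k v ≡ true
  stage-closed k stable {u} {v} Cu Ruv = stable v (∨-introʳ _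
    (anyFin-intro _ (index u)
      (∧-intro (subst (λ w → stage k w ≡ true) (sym (enum-index u)) Cu)
               (dec-true (R? _ v) (subst (λ w → R w v) (sym (enum-index u)) Ruv)))))

  component : Component R s
  component = record
    { member    = stage k
    ; source    = stage-source k
    ; reachable = stage-reachable k
    ; closed    = stage-closed k stable
    }
    where
    limit : ∃ λ k → (λ i → stage (suc k) (enum i)) ⊆ (λ i → stage k (enum i))
    limit = stabilises (λ k i → stage k (enum i)) (λ k i → stage-increasing k (enum i))
    k : ℕ
    k = proj₁ limit
    stable : stage (suc k) ⊆ stage k
    stable v p = subst (λ w → stage k w ≡ true) (enum-index v)
      (proj₂ limit (index v) (subst (λ w → stage (suc k) w ≡ true) (sym (enum-index v)) p))

module Bipartite {ℓD ℓS : ℕ} (e : Fin ℓD → Fin ℓS → Bool) where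

  Adj? : ∀ u v → Dec (Adj e u v)
  Adj? (inj₁ i) (inj₂ j) = e i j ≟ᵇ true
  Adj? (inj₂ j) (inj₁ i) = e i j ≟ᵇ true
  Adj? (inj₁ _) (inj₁ _) = no λ ()
  Adj? (inj₂ _) (inj₂ _) = no λ ()

  componentOf : ∀ u → Component (Adj e) u
  componentOf = FiniteComponent.component (splitAt ℓD) (join ℓD ℓS) (splitAt-join ℓD ℓS) Adj?

  member-edge : ∀ {u} (K : Component (Adj e) u) {i j} → e i j ≡ true →
    Component.member K (inj₁ i) ≡ Component.member K (inj₂ j)
  member-edge K {i} {j} eij with Component.member K (inj₁ i) in Ki | Component.member K (inj₂ j) in Kj
  ... | true  | true  = refl
  ... | false | false = refl
  ... | true  | false = ⊥-elim (true≢false (Component.closed K Ki eij) Kj)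
  ... | false | true  = ⊥-elim (true≢false (Component.closed K Kj eij) Ki)

  record DemandCut (Dv : Fin ℓD → Bool) : Set where
    field
      side     : Fin ℓD → Bool
      respects : ∀ {a b j} → e a j ≡ true → e b j ≡ true → side a ≡ side b
      x y      : Fin ℓD
      x∈Dv     : Dv x ≡ true
      y∈Dv     : Dv y ≡ true
      x-inside : side x ≡ true
      y-outside : side y ≡ false

  module _ (Dv : Fin ℓD → Bool) (Sv : Fin ℓS → Bool)
      (neighbour : ∀ j → Sv j ≡ true → ∃ λ i → Dv i ≡ true × e i j ≡ true)
      {u} (u∈ : InV Dv Sv u) where
    open Component (componentOf u)

    demandRep : ∀ w → InV Dv Sv w → ∃ λ i → Dv i ≡ true × member (inj₁ i) ≡ member w
    demandRep (inj₁ i) i∈ = i , i∈ , refl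
    demandRep (inj₂ j) j∈ with neighbour j j∈
    ... | i , i∈ , eij = i , i∈ , member-edge (componentOf u) eij

    componentCut : ∀ {v} → InV Dv Sv v → member v ≡ false → DemandCut Dv
    componentCut {v} v∈ v-out = record
      { side      = λ i → member (inj₁ i)
      ; respects  = λ eaj ebj →
          trans (member-edge (componentOf u) eaj) (sym (member-edge (componentOf u) ebj))
      ; x         = proj₁ (demandRep u u∈)
      ; y         = proj₁ (demandRep v v∈)
      ; x∈Dv      = proj₁ (proj₂ (demandRep u u∈))
      ; y∈Dv      = proj₁ (proj₂ (demandRep v v∈))
      ; x-inside  = trans (proj₂ (proj₂ (demandRep u u∈))) source
      ; y-outside = trans (proj₂ (proj₂ (demandRep v v∈))) v-out
      }

  connected-unless-cut : ∀ Dv Sv →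
    (∀ j → Sv j ≡ true → ∃ λ i → Dv i ≡ true × e i j ≡ true) →
    ¬ DemandCut Dv → Connected Dv Sv e
  connected-unless-cut Dv Sv neighbour noCut u v u∈ v∈
    with Component.member (componentOf u) v in v-in
  ... | true = Component.reachable (componentOf u) v-in
  ... | false = ⊥-elim (noCut (componentCut Dv Sv neighbour u∈ v∈ v-in))

supply-has-neighbour : ∀ {ℓD ℓS} (E : Fin ℓD → Fin ℓS → Bool) → Connected allV allV E →
  Fin ℓD → ∀ j → ∃ λ i → E i j ≡ true
supply-has-neighbour E connected i₀ j = firstStep (connected (inj₂ j) (inj₁ i₀) refl refl)
  where
  firstStep : Star (Adj E) (inj₂ j) (inj₁ i₀) → ∃ λ i → E i j ≡ true
  firstStep (_◅_ {j = inj₁ i} Eij _) = i , Eij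

module FieldFacts (F : OrderedField) where
  open OrderedField F

  commutativeRing : CommutativeRing _ _
  commutativeRing = record { isCommutativeRing = isCommutativeRing }

  open CommutativeRing commutativeRing public
    using (+-identityˡ; +-identityʳ; +-comm; -‿inverseʳ; *-identityʳ;
           zeroˡ; zeroʳ; distribˡ; distribʳ; *-comm; *-assoc)
  open SemiringSum (CommutativeRing.semiring commutativeRing)
    using (sum; sum-cong-≗; ∑-distrib-+; ∑-comm; *-distribˡ-sum; sum-replicate-zero)
  open IsTotalOrder ≤-isTotalOrder using (antisym) renaming (trans to ≤-trans′)
  open ≡-Reasoning

  infix 7 _⋅_
  _⋅_ : ∀ {n} → (Fin n → Carrier) → (Fin n → Carrier) → Carrier
  _⋅_ = _·_ F

  Σ≡sum : ∀ {n} (f : Fin n → Carrier) → Σ F f ≡ sum f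
  Σ≡sum {zero} f = refl
  Σ≡sum {suc n} f = cong (f zero +_) (Σ≡sum (f ∘ suc))

  Σ-cong : ∀ {n} {f g : Fin n → Carrier} → (∀ k → f k ≡ g k) → Σ F f ≡ Σ F g
  Σ-cong {f = f} {g} f≗g =
    trans (Σ≡sum f) (trans (sum-cong-≗ f≗g) (sym (Σ≡sum g)))

  Σ-+ : ∀ {n} (f g : Fin n → Carrier) → Σ F (λ k → f k + g k) ≡ Σ F f + Σ F g
  Σ-+ f g = trans (Σ≡sum (λ k → f k + g k))
    (trans (∑-distrib-+ f g) (sym (cong₂ _+_ (Σ≡sum f) (Σ≡sum g))))

  Σ-swap : ∀ {m n} (f : Fin m → Fin n → Carrier) →
    Σ F (λ i → Σ F (λ j → f i j)) ≡ Σ F (λ j → Σ F (λ i → f i j))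
  Σ-swap f = begin
    Σ F (λ i → Σ F (f i))          ≡⟨ Σ-cong (λ i → Σ≡sum (f i)) ⟩
    Σ F (λ i → sum (f i))          ≡⟨ Σ≡sum (λ i → sum (f i)) ⟩
    sum (λ i → sum (f i))          ≡⟨ ∑-comm f ⟩
    sum (λ j → sum (λ i → f i j))  ≡⟨ sym (Σ≡sum (λ j → sum (λ i → f i j))) ⟩
    Σ F (λ j → sum (λ i → f i j))  ≡⟨ sym (Σ-cong (λ j → Σ≡sum (λ i → f i j))) ⟩
    Σ F (λ j → Σ F (λ i → f i j))  ∎

  Σ-*ˡ : ∀ {n} c (f : Fin n → Carrier) → Σ F (λ k → c * f k) ≡ c * Σ F f
  Σ-*ˡ c f = trans (Σ≡sum (λ k → c * f k)) (trans (sym (*-distribˡ-sum c f)) (cong (c *_) (sym (Σ≡sum f))))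

  Σ-zero : ∀ {n} {f : Fin n → Carrier} → (∀ k → f k ≡ 0#) → Σ F f ≡ 0#
  Σ-zero {n} f≗0 = trans (Σ-cong f≗0) (trans (Σ≡sum {n} (λ _ → 0#)) (sum-replicate-zero n))

  ⋅-congˡ : ∀ {n} {u v : Fin n → Carrier} (w : Fin n → Carrier) →
    (∀ k → u k ≡ v k) → u ⋅ w ≡ v ⋅ w
  ⋅-congˡ w u≗v = Σ-cong (λ k → cong (_* w k) (u≗v k))

  ⋅-distribʳ : ∀ {n} (u v w : Fin n → Carrier) → (λ k → u k + v k) ⋅ w ≡ u ⋅ w + v ⋅ w
  ⋅-distribʳ u v w = trans (Σ-cong (λ k → distribʳ (w k) (u k) (v k)))
                            (Σ-+ (λ k → u k * w k) (λ k → v k * w k))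

  ⋅-zeroˡ : ∀ {n} {u : Fin n → Carrier} (w : Fin n → Carrier) → (∀ k → u k ≡ 0#) → u ⋅ w ≡ 0#
  ⋅-zeroˡ w u≗0 = Σ-zero (λ k → trans (cong (_* w k) (u≗0 k)) (zeroˡ (w k)))

  𝟏-suc : ∀ {n} (a k : Fin n) → 𝟏 F (suc a) (suc k) ≡ 𝟏 F a k
  𝟏-suc a k with a ≟ k
  ... | yes _ = refl
  ... | no _ = refl

  ⋅-unit : ∀ {n} (w : Fin n → Carrier) a → w ⋅ 𝟏 F a ≡ w a
  ⋅-unit {suc n} w zero = begin
    w zero * 1# + Σ F (λ k → w (suc k) * 0#) ≡⟨ cong₂ _+_ (*-identityʳ _) (Σ-zero {n} (λ k → zeroʳ (w (suc k)))) ⟩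
    w zero + 0#                               ≡⟨ +-identityʳ _ ⟩
    w zero                                    ∎
  ⋅-unit {suc n} w (suc a) = begin
    w zero * 0# + Σ F (λ k → w (suc k) * 𝟏 F (suc a) (suc k))
      ≡⟨ cong (w zero * 0# +_) (Σ-cong (λ k → cong (w (suc k) *_) (𝟏-suc a k))) ⟩
    w zero * 0# + Σ F (λ k → w (suc k) * 𝟏 F a k)
      ≡⟨ cong₂ _+_ (zeroʳ _) (⋅-unit (w ∘ suc) a) ⟩
    0# + w (suc a)
      ≡⟨ +-identityˡ _ ⟩
    w (suc a) ∎

  ⋅-arrival : ∀ {ℓD ℓS} (w : Fin (ℓD Data.Nat.+ ℓS) → Carrier) i j →
    w ⋅ arrival F i j ≡ w (i ↑ˡ ℓS) + w (ℓD ↑ʳ j)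
  ⋅-arrival {ℓD} {ℓS} w i j = begin
    Σ F (λ k → w k * (𝟏 F (i ↑ˡ ℓS) k + 𝟏 F (ℓD ↑ʳ j) k))
      ≡⟨ Σ-cong (λ k → distribˡ (w k) _ _) ⟩
    Σ F (λ k → w k * 𝟏 F (i ↑ˡ ℓS) k + w k * 𝟏 F (ℓD ↑ʳ j) k)
      ≡⟨ Σ-+ (λ k → w k * 𝟏 F (i ↑ˡ ℓS) k) (λ k → w k * 𝟏 F (ℓD ↑ʳ j) k) ⟩
    w ⋅ 𝟏 F (i ↑ˡ ℓS) + w ⋅ 𝟏 F (ℓD ↑ʳ j)
      ≡⟨ cong₂ _+_ (⋅-unit w _) (⋅-unit w _) ⟩
    w (i ↑ˡ ℓS) + w (ℓD ↑ʳ j) ∎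

  ⋅-mean : ∀ {ℓD ℓS} (p : Fin ℓD → Fin ℓS → Carrier) (w : Fin (ℓD Data.Nat.+ ℓS) → Carrier) →
    w ⋅ mean F p ≡ Σ F (λ i → Σ F (λ j → p i j * (w (i ↑ˡ ℓS) + w (ℓD ↑ʳ j))))
  ⋅-mean {ℓD} {ℓS} p w = begin
    Σ F (λ k → w k * Σ F (λ i → Σ F (λ j → term i j k)))
      ≡⟨ Σ-cong (λ k → sym (distribute k)) ⟩
    Σ F (λ k → Σ F (λ i → Σ F (λ j → w k * term i j k)))
      ≡⟨ Σ-swap (λ k i → Σ F (λ j → w k * term i j k)) ⟩
    Σ F (λ i → Σ F (λ k → Σ F (λ j → w k * term i j k)))
      ≡⟨ Σ-cong (λ i → Σ-swap (λ k j → w k * term i j k)) ⟩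
    Σ F (λ i → Σ F (λ j → Σ F (λ k → w k * term i j k)))
      ≡⟨ Σ-cong (λ i → Σ-cong (λ j → pull-out i j)) ⟩
    Σ F (λ i → Σ F (λ j → p i j * (w ⋅ arrival F i j)))
      ≡⟨ Σ-cong (λ i → Σ-cong (λ j → cong (p i j *_) (⋅-arrival w i j))) ⟩
    Σ F (λ i → Σ F (λ j → p i j * (w (i ↑ˡ ℓS) + w (ℓD ↑ʳ j)))) ∎
    where
    term : Fin ℓD → Fin ℓS → Fin (ℓD Data.Nat.+ ℓS) → Carrier
    term i j k = p i j * arrival F i j k
    distribute : ∀ k → Σ F (λ i → Σ F (λ j → w k * term i j k)) ≡ w k * Σ F (λ i → Σ F (λ j → term i j k))
    distribute k = trans (Σ-cong (λ i → Σ-*ˡ (w k) (λ j → term i j k)))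
                         (Σ-*ˡ (w k) (λ i → Σ F (λ j → term i j k)))
    pull-out : ∀ i j → Σ F (λ k → w k * term i j k) ≡ p i j * (w ⋅ arrival F i j)
    pull-out i j = trans (Σ-cong (λ k → trans (sym (*-assoc (w k) (p i j) _))
      (trans (cong (_* arrival F i j k) (*-comm (w k) (p i j))) (*-assoc (p i j) (w k) _))))
      (Σ-*ˡ (p i j) (λ k → w k * arrival F i j k))

  -0≡0 : - 0# ≡ 0#
  -0≡0 = trans (sym (+-identityˡ (- 0#))) (-‿inverseʳ 0#)

  no-two-below : ∀ {a b d} → a ≤ - d → b ≤ - d → 0# < d → a + b ≡ 0# → ⊥
  no-two-below {a} {b} {d} a≤-d b≤-d (0≤d , 0≢d) a+b≡0 = 0≢d (sym d≡0)
    where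
    +-monoʳ-≤ : ∀ {x y} z → x ≤ y → z + x ≤ z + y
    +-monoʳ-≤ {x} {y} z x≤y = subst₂ _≤_ (+-comm x z) (+-comm y z) (+-monoˡ-≤ z x≤y)
    -d≤0 : - d ≤ 0#
    -d≤0 = subst₂ _≤_ (+-identityˡ (- d)) (-‿inverseʳ d) (+-monoˡ-≤ (- d) 0≤d)
    0≤-d : 0# ≤ - d
    0≤-d = subst (_≤ - d) a+b≡0 (≤-trans′ (+-monoˡ-≤ b a≤-d)
             (≤-trans′ (+-monoʳ-≤ (- d) b≤-d)
             (subst (- d + - d ≤_) (+-identityʳ (- d)) (+-monoʳ-≤ (- d) -d≤0))))
    d≡0 : d ≡ 0#
    d≡0 = begin
      d          ≡⟨ sym (+-identityʳ d) ⟩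
      d + 0#     ≡⟨ cong (d +_) (antisym 0≤-d -d≤0) ⟩
      d + - d    ≡⟨ -‿inverseʳ d ⟩
      0#         ∎

module Drift (F : OrderedField) {ℓD ℓS : ℕ} (E : Fin ℓD → Fin ℓS → Bool)
             (p : Fin ℓD → Fin ℓS → OrderedField.Carrier F) where
  open OrderedField F
  open FieldFacts F
  open Neighbours E
  open ≡-Reasoning

  drift : (Fin ℓD → Bool) → Carrier
  drift X = ξ F E X ⋅ mean F p

  -- ξ^X has the coordinates  ind 1# (X i)  and  ind (- 1#) (𝒮 X j).
  ind : Carrier → Bool → Carrier
  ind c b = if b then c else 0#

  ind-modular : ∀ c a b → ind c a + ind c b ≡ ind c (a ∧ b) + ind c (a ∨ b)
  ind-modular c true  true  = refl
  ind-modular c true  false = +-comm c 0#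
  ind-modular c false b     = refl

  drift-cong : ∀ {X Y} → (∀ i → X i ≡ Y i) → drift X ≡ drift Y
  drift-cong {X} {Y} X≗Y = ⋅-congˡ (mean F p) ξ-cong
    where
    ξ-cong : ∀ k → ξ F E X k ≡ ξ F E Y k
    ξ-cong k with splitAt ℓD k
    ... | inj₁ i = cong (ind 1#) (X≗Y i)
    ... | inj₂ j = cong (ind (- 1#)) (𝒮-cong X≗Y j)

  drift-modular : ∀ X Y →
    (∀ {a b j} → X a ≡ true → Y b ≡ true → E a j ≡ true → E b j ≡ true → 𝒮 E (X ∩ Y) j ≡ true) →
    drift X + drift Y ≡ drift (X ∩ Y) + drift (X ∪ Y)
  drift-modular X Y shared = begin
    drift X + drift Y
      ≡⟨ sym (⋅-distribʳ (ξ F E X) (ξ F E Y) (mean F p)) ⟩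
    (λ k → ξ F E X k + ξ F E Y k) ⋅ mean F p
      ≡⟨ ⋅-congˡ (mean F p) ξ-modular ⟩
    (λ k → ξ F E (X ∩ Y) k + ξ F E (X ∪ Y) k) ⋅ mean F p
      ≡⟨ ⋅-distribʳ (ξ F E (X ∩ Y)) (ξ F E (X ∪ Y)) (mean F p) ⟩
    drift (X ∩ Y) + drift (X ∪ Y) ∎
    where
    ξ-modular : ∀ k → ξ F E X k + ξ F E Y k ≡ ξ F E (X ∩ Y) k + ξ F E (X ∪ Y) k
    ξ-modular k with splitAt ℓD k
    ... | inj₁ i = ind-modular 1# (X i) (Y i)
    ... | inj₂ j rewrite 𝒮-∩ X Y shared j | 𝒮-∪ X Y j = ind-modular (- 1#) (𝒮 E X j) (𝒮 E Y j)

  drift-∅ : drift (λ _ → false) ≡ 0#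
  drift-∅ = ⋅-zeroˡ (mean F p) ξ-∅
    where
    ξ-∅ : ∀ k → ξ F E (λ _ → false) k ≡ 0#
    ξ-∅ k with splitAt ℓD k
    ... | inj₁ i = refl
    ... | inj₂ j = cong (ind (- 1#)) (𝒮-∅ j)

  -- When every supply class has a neighbour, ξ^𝒟 vanishes on every arrival
  -- 1^i + 1^j, hence so does its drift.
  drift-all : (∀ j → 𝒮 E allV j ≡ true) → drift allV ≡ 0#
  drift-all covered = begin
    ξ F E allV ⋅ mean F p
      ≡⟨ ⋅-mean p (ξ F E allV) ⟩
    Σ F (λ i → Σ F (λ j → p i j * (ξ F E allV (i ↑ˡ ℓS) + ξ F E allV (ℓD ↑ʳ j))))
      ≡⟨ Σ-zero (λ i → Σ-zero (λ j → trans (cong (p i j *_) (balanced i j)) (zeroʳ (p i j)))) ⟩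
    0# ∎
    where
    balanced : ∀ i j → ξ F E allV (i ↑ˡ ℓS) + ξ F E allV (ℓD ↑ʳ j) ≡ 0#
    balanced i j rewrite splitAt-↑ˡ ℓD i ℓS | splitAt-↑ʳ ℓD ℓS j | covered j = -‿inverseʳ 1#

  module Rigidity (D : Fin ℓD → Bool) {δ̲ : Carrier} (0<δ̲ : 0# < δ̲)
      (drift-D : drift D ≡ - 0#)
      (drift-other : ∀ D' → Nonempty D' → Proper D' → ¬ (∀ i → D' i ≡ D i) → drift D' ≤ - δ̲)
      where

    no-separating-pair : ∀ {X Y x y} → X x ≡ true → X y ≡ false → Y y ≡ true → Y x ≡ false →
      D x ≡ D y → drift X + drift Y ≡ 0# → ⊥
    no-separating-pair {X} {Y} {x} {y} Xx Xy Yy Yx Dx≡Dy =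
      no-two-below (drift-other X (x , Xx) (y , Xy) (differs X Xx Xy Dx≡Dy))
                   (drift-other Y (y , Yy) (x , Yx) (differs Y Yy Yx (sym Dx≡Dy))) 0<δ̲
      where
      differs : ∀ Z {u v} → Z u ≡ true → Z v ≡ false → D u ≡ D v → ¬ (∀ i → Z i ≡ D i)
      differs Z {u} {v} Zu Zv Du≡Dv Z≗D =
        true≢false (trans (sym (trans (Z≗D u) (trans Du≡Dv (sym (Z≗D v))))) Zu) Zv

    e₁ : Fin ℓD → Fin ℓS → Bool
    e₁ i j = E i j ∧ D i ∧ 𝒮 E D j

    edge₁ : ∀ {i j} → D i ≡ true → E i j ≡ true → e₁ i j ≡ true
    edge₁ Di Eij = ∧-intro Eij (∧-intro Di (𝒮-intro D Di Eij))

    -- A cut C of D in 𝒢₁ splits D into X = D ∩ C and Y = D ∖ C with disjoint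
    -- neighbourhoods, so ξ^D = ξ^X + ξ^Y and drift X + drift Y = drift D = 0.
    𝒢₁-no-cut : ¬ Bipartite.DemandCut e₁ D
    𝒢₁-no-cut cut = no-separating-pair {X} {Y} Xx Xy Yy Yx (trans x∈Dv (sym y∈Dv)) drifts-cancel
      where
      open Bipartite.DemandCut cut
      X Y : Fin ℓD → Bool
      X i = D i ∧ side i
      Y i = D i ∧ not (side i)
      Xx : X x ≡ true
      Xx = ∧-intro x∈Dv x-inside
      Xy : X y ≡ false
      Xy = cong₂ _∧_ y∈Dv y-outside
      Yy : Y y ≡ true
      Yy = ∧-intro y∈Dv (cong not y-outside)
      Yx : Y x ≡ false
      Yx = cong₂ (λ d c → d ∧ not c) x∈Dv x-inside
      disjoint : ∀ {a b j} → X a ≡ true → Y b ≡ true → E a j ≡ true → E b j ≡ true → 𝒮 E (X ∩ Y) j ≡ true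
      disjoint {a} {b} Xa Yb Eaj Ebj with ∧-elim {D a} Xa | ∧-elim {D b} Yb
      ... | Da , Ca | Db , ¬Cb = ⊥-elim (true≢false
            (trans (sym (respects (edge₁ Da Eaj) (edge₁ Db Ebj))) Ca) (not-true ¬Cb))
      drifts-cancel : drift X + drift Y ≡ 0#
      drifts-cancel = begin
        drift X + drift Y              ≡⟨ drift-modular X Y disjoint ⟩
        drift (X ∩ Y) + drift (X ∪ Y)  ≡⟨ cong₂ _+_ (trans (drift-cong (λ i → split-∩ (D i) (side i))) drift-∅)
                                                    (trans (drift-cong (λ i → split-∪ (D i) (side i))) drift-D) ⟩
        0# + - 0#                      ≡⟨ trans (+-identityˡ (- 0#)) -0≡0 ⟩
        0#                             ∎

    𝒢₁-connected : Connected D (𝒮 E D) e₁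
    𝒢₁-connected = Bipartite.connected-unless-cut e₁ D (𝒮 E D) neighbour 𝒢₁-no-cut
      where
      neighbour : ∀ j → 𝒮 E D j ≡ true → ∃ λ i → D i ≡ true × e₁ i j ≡ true
      neighbour j Sj with 𝒮-witness D Sj
      ... | i , Di , Eij = i , Di , edge₁ Di Eij

    module _ (covered : ∀ j → ∃ λ i → E i j ≡ true) where

      e₂ : Fin ℓD → Fin ℓS → Bool
      e₂ i j = E i j ∧ not (D i) ∧ not (𝒮 E D j)

      edge₂ : ∀ {i j} → D i ≡ false → 𝒮 E D j ≡ false → E i j ≡ true → e₂ i j ≡ true
      edge₂ Di Sj Eij = ∧-intro Eij (∧-intro (cong not Di) (cong not Sj))

      outside-D : ∀ {i j} → 𝒮 E D j ≡ false → E i j ≡ true → D i ≡ false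
      outside-D Sj Eij = false-if (λ Di → 𝒮-intro D Di Eij) Sj

      -- A cut C of 𝒟 ∖ D in 𝒢₂ gives the sets X = D ∪ C and Y = D ∪ (𝒟 ∖ C),
      -- with X ∩ Y = D and X ∪ Y = 𝒟, so drift X + drift Y = drift D + drift 𝒟 = 0.
      𝒢₂-no-cut : ¬ Bipartite.DemandCut e₂ (not ∘ D)
      𝒢₂-no-cut cut = no-separating-pair {X} {Y} Xx Xy Yy Yx (trans Dx (sym Dy)) drifts-cancel
        where
        open Bipartite.DemandCut cut
        Dx : D x ≡ false
        Dx = not-true x∈Dv
        Dy : D y ≡ false
        Dy = not-true y∈Dv
        X Y : Fin ℓD → Bool
        X i = D i ∨ side i
        Y i = D i ∨ not (side i)
        Xx : X x ≡ true
        Xx = ∨-introʳ (D x) x-inside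
        Xy : X y ≡ false
        Xy = cong₂ _∨_ Dy y-outside
        Yy : Y y ≡ true
        Yy = ∨-introʳ (D y) (cong not y-outside)
        Yx : Y x ≡ false
        Yx = cong₂ (λ d c → d ∨ not c) Dx x-inside
        shared : ∀ {a b j} → X a ≡ true → Y b ≡ true → E a j ≡ true → E b j ≡ true → 𝒮 E (X ∩ Y) j ≡ true
        shared {a} {b} {j} Xa Yb Eaj Ebj with 𝒮 E D j in Sj
        ... | true with 𝒮-witness D Sj
        ...   | c , Dc , Ecj = 𝒮-intro (X ∩ Y) (trans (extend-∩ (D c) (side c)) Dc) Ecj
        shared {a} {b} {j} Xa Yb Eaj Ebj | false = ⊥-elim (true≢false
            (trans (sym (respects (edge₂ Da Sj Eaj) (edge₂ Db Sj Ebj))) (∨-resolve Xa Da))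
            (not-true (∨-resolve Yb Db)))
          where
          Da : D a ≡ false
          Da = outside-D Sj Eaj
          Db : D b ≡ false
          Db = outside-D Sj Ebj
        drifts-cancel : drift X + drift Y ≡ 0#
        drifts-cancel = begin
          drift X + drift Y              ≡⟨ drift-modular X Y shared ⟩
          drift (X ∩ Y) + drift (X ∪ Y)  ≡⟨ cong₂ _+_ (trans (drift-cong (λ i → extend-∩ (D i) (side i))) drift-D)
                                                      (trans (drift-cong (λ i → extend-∪ (D i) (side i)))
                                                             (drift-all (λ j → 𝒮-intro allV refl (proj₂ (covered j))))) ⟩
          - 0# + 0#                      ≡⟨ trans (+-identityʳ (- 0#)) -0≡0 ⟩
          0#                             ∎

      𝒢₂-connected : Connected (not ∘ D) (not ∘ 𝒮 E D) e₂
      𝒢₂-connected = Bipartite.connected-unless-cut e₂ (not ∘ D) (not ∘ 𝒮 E D) neighbour 𝒢₂-no-cut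
        where
        neighbour : ∀ j → not (𝒮 E D j) ≡ true → ∃ λ i → not (D i) ≡ true × e₂ i j ≡ true
        neighbour j ¬Sj with covered j
        ... | i , Eij = i , cong not (outside-D Sj Eij) , edge₂ (outside-D Sj Eij) Sj Eij
          where
          Sj : 𝒮 E D j ≡ false
          Sj = not-true ¬Sj

mainTheorem4 :
    (F : OrderedField) → let open OrderedField F in
    (ℓD ℓS : ℕ) (E : Fin ℓD → Fin ℓS → Bool) →
    Connected allV allV E →
    (A : Fin ℓD → Fin ℓS → Bool) →
    (δ̄ : Carrier) → 0# < δ̄ → δ̄ < 1# →
    (p : Carrier → Fin ℓD → Fin ℓS → Carrier) →
    (∀ δ → 0# ≤ δ → δ ≤ δ̄ → IsLawOn F A (p δ)) →
    (D : Fin ℓD → Bool) → Nonempty D → Proper D →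
    (δ̲ : Carrier) → 0# < δ̲ →
    (∀ δ → 0# ≤ δ → δ ≤ δ̄ → _·_ F (ξ F E D) (mean F (p δ)) ≡ - δ) →
    (∀ (D' : Fin ℓD → Bool) → Nonempty D' → Proper D' → ¬ (∀ i → D' i ≡ D i) →
      ∀ δ → 0# ≤ δ → δ ≤ δ̄ → _·_ F (ξ F E D') (mean F (p δ)) ≤ - δ̲) →
    Connected D (𝒮 E D) (λ i j → E i j ∧ D i ∧ 𝒮 E D j)
    × Connected (λ i → not (D i)) (λ j → not (𝒮 E D j))
                (λ i j → E i j ∧ not (D i) ∧ not (𝒮 E D j))
mainTheorem4 F ℓD ℓS E connected _ δ̄ 0<δ̄ _ p _ D (i₀ , _) _ δ̲ 0<δ̲ drift-D drift-other =
  𝒢₁-connected , 𝒢₂-connected (supply-has-neighbour E connected i₀)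
  where
  open OrderedField F
  0≤0 : 0# ≤ 0#
  0≤0 = IsTotalOrder.reflexive ≤-isTotalOrder refl
  open Drift.Rigidity F E (p 0#) D 0<δ̲ (drift-D 0# 0≤0 (proj₁ 0<δ̄))
    (λ D' nonempty proper ≢D → drift-other D' nonempty proper ≢D 0# 0≤0 (proj₁ 0<δ̄))
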